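{- Let $c\geq1$ be an integer and $g\colon\mathbb{N}\to\mathbb{N}$ a function. Then there is a function $h[g]\colon\mathbb{N}\to\mathbb{N}$ such that for every $g$-transformation sequence $(A_1,b_1),\dots,(A_r,b_r)$ of $c$-BBPs we have $r\leq h[g](n(A_1,b_1))$.
   Context: A bare bones $c$-pair ($c$-BBP) is a pair $(A,b)$ where $A$ is a finite multiset of integers in $[1,c]$ and $b$ is a non-negative integer; $n(A,b)=2^b+\sum_{x\in A}x$ (each element counted with multiplicity). If $c\in A$, a folding of $(A,b)$ is $(A',b')$ where $A'$ is $A$ with the multiplicity of $c$ reduced by one and $b'=b+d$ for some non-negative integer $d$. If $x\in A$ with $x<c$, an extension of $(A,b)$ is $(A',b')$ where $A'$ is obtained from $A$ by removing one occurrence of $x$ and adding $d_1$ occurrences of $x+1$, and $b'=b+d_2$, for some non-negative integers $d_1,d_2$. $(A',b')$ is a $g$-transformation of $(A,b)$ if it is a folding or an extension of $(A,b)$ and $n(A',b')\leq g(n(A,b))$. A $g$-transformation sequence is a sequence of $c$-BBPs $(A_1,b_1),\dots,(A_r,b_r)$ such that for each $2\leq i\leq r$, $(A_i,b_i)$ is a $g$-transformation of $(A_{i-1},b_{i-1})$. -}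

module Defs where

open import Data.Nat using (ℕ; zero; suc; _+_; _^_; _≤_; _<_)
open import Data.List using (List; []; _∷_; _++_; replicate; length)
open import Data.Nat.ListAction using (sum)
open import Data.Empty using (⊥)
open import Relation.Binary.PropositionalEquality using (_≡_)
open import Data.List.Relation.Unary.All using (All)
open import Data.List.Relation.Binary.Permutation.Propositional using (_↭_)
open import Data.Product using (_×_; _,_; Σ; ∃; ∃-syntax)
open import Data.Sum using (_⊎_)

-- A bare bones pair: a finite multiset A of naturals (a list, considered up
-- to permutation) together with a natural number b.
record BBP : Set where
  constructor bbp
  field
    A : List ℕ
    b : ℕ
open BBP public

IsCBBP : ℕ → BBP → Set
IsCBBP c P = All (λ x → 1 ≤ x × x ≤ c) (A P)

nOf : BBP → ℕ
nOf P = 2 ^ b P + sum (A P)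

IsFolding : ℕ → BBP → BBP → Set
IsFolding c P Q = (A P ↭ c ∷ A Q) × (∃[ d ] b Q ≡ b P + d)

IsExtension : ℕ → BBP → BBP → Set
IsExtension c P Q =
  ∃[ x ] ∃[ A₀ ] ∃[ d₁ ] ∃[ d₂ ]
    (x < c) × (A P ↭ x ∷ A₀) × (A Q ↭ replicate d₁ (suc x) ++ A₀)
    × (b Q ≡ b P + d₂)

IsGTransformation : ℕ → (ℕ → ℕ) → BBP → BBP → Set
IsGTransformation c g P Q =
  (IsFolding c P Q ⊎ IsExtension c P Q) × (nOf Q ≤ g (nOf P))

data GSeqFrom (c : ℕ) (g : ℕ → ℕ) : BBP → List BBP → Set where
  [_]  : ∀ {P} → IsCBBP c P → GSeqFrom c g P []
  _∷⟨_⟩_ : ∀ {P Q rest} → IsCBBP c P → IsGTransformation c g P Q →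
           GSeqFrom c g Q rest → GSeqFrom c g P (Q ∷ rest)

IsGTransformationSequence : ℕ → (ℕ → ℕ) → List BBP → Set
IsGTransformationSequence c g []           = ⊥
IsGTransformationSequence c g (P ∷ rest) = GSeqFrom c g P rest

-- n(A₁,b₁) for a (nonempty) sequence; value at [] irrelevant.
firstN : List BBP → ℕ
firstN []      = 0
firstN (P ∷ _) = nOf P

-- Record a multiset A ⊆ [1, c] by its vector of multiplicities (m₁, …, m_c). A folding lowers m_c
-- and an extension at x lowers m_x, leaving every m_y with y < x unchanged, so each step decreases
-- the vector lexicographically; the entries may grow, but never beyond the current n(A, b), which in
-- turn grows per step by at most a monotone inflationary envelope G of g. Such a lexicographic descent
-- has bounded length, by induction on the number of coordinates: while the leading coordinate stays
-- constant the run is bounded by the tail's bound, and the leading coordinate, initially at most n,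
-- can drop at most n times, each time restarting from a size bounded by iterating G.
module Submission where

open import Defs
open import Data.Nat using (ℕ; zero; suc; _+_; _≤_; _<_; _^_; _≟_; z≤n; s≤s)
open import Data.Nat.Properties
open import Data.Nat.GeneralisedArithmetic using (iterate)
open import Data.Nat.ListAction using (sum)
open import Data.List using (List; []; _∷_; _++_; length; replicate; filter)
open import Data.List.Properties using (length-++; filter-++; filter-none; filter-accept; filter-reject)
open import Data.List.Relation.Unary.Any using (here)
import Data.List.Relation.Unary.All as List
open import Data.List.Relation.Unary.All.Properties using (replicate⁺)
open import Data.List.Relation.Binary.Permutation.Propositional using (_↭_; ↭-sym)
open import Data.List.Relation.Binary.Permutation.Propositional.Properties
  using (↭-length; filter-↭; ∈-resp-↭)
open import Data.Vec using (Vec; head; tail) renaming ([] to []ᵥ; _∷_ to _∷ᵥ_)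
open import Data.Vec.Relation.Unary.All using (All) renaming ([] to []ₐ; _∷_ to _∷ₐ_)
open import Data.Vec.Relation.Binary.Lex.Strict using (Lex-<; base; this; next)
open import Data.Product using (Σ-syntax; ∃-syntax; _×_; _,_; proj₁; proj₂)
open import Data.Sum using (_⊎_; inj₁; inj₂)
open import Function using (_∘_)
open import Relation.Nullary using (yes; no; ¬_; contradiction)
open import Relation.Binary.Core using (_Preserves_⟶_)
open import Relation.Binary.PropositionalEquality
  using (_≡_; _≢_; refl; sym; trans; cong; module ≡-Reasoning)

iterate-comm : ∀ {A : Set} (f : A → A) x n → iterate f (f x) n ≡ f (iterate f x n)
iterate-comm f x zero    = refl
iterate-comm f x (suc n) = iterate-comm f (f x) n

module _ {G : ℕ → ℕ} (G-mono : G Preserves _≤_ ⟶ _≤_) where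

  iterate-monoˡ-≤ : ∀ n {x y} → x ≤ y → iterate G x n ≤ iterate G y n
  iterate-monoˡ-≤ zero    x≤y = x≤y
  iterate-monoˡ-≤ (suc n) x≤y = iterate-monoˡ-≤ n (G-mono x≤y)

module _ {G : ℕ → ℕ} (G-infl : ∀ n → n ≤ G n) where

  iterate-infl : ∀ x n → x ≤ iterate G x n
  iterate-infl x zero    = ≤-refl
  iterate-infl x (suc n) = ≤-trans (G-infl x) (iterate-infl (G x) n)

  iterate-monoʳ-≤ : ∀ x {m n} → m ≤ n → iterate G x m ≤ iterate G x n
  iterate-monoʳ-≤ x {zero}  {n}     _   = iterate-infl x n
  iterate-monoʳ-≤ x {suc m} {suc n} m≤n = iterate-monoʳ-≤ (G x) (≤-pred m≤n)

data Path {S : Set} (_↝_ : S → S → Set) : S → S → ℕ → Set where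
  ε   : ∀ {s} → Path _↝_ s s 0
  _◅_ : ∀ {s t u p} → s ↝ t → Path _↝_ t u p → Path _↝_ s u (suc p)

infixr 5 _◅_

_<ₗₑₓ_ : ∀ {k} → Vec ℕ k → Vec ℕ k → Set
_<ₗₑₓ_ = Lex-< _≡_ _<_

¬[]<ₗₑₓ[] : ∀ {u v : Vec ℕ 0} → ¬ u <ₗₑₓ v
¬[]<ₗₑₓ[] {[]ᵥ} {[]ᵥ} (base ())

<ₗₑₓ⇒head-≤ : ∀ {k} {u v : Vec ℕ (suc k)} → u <ₗₑₓ v → head u ≤ head v
<ₗₑₓ⇒head-≤ {u = _ ∷ᵥ _} {_ ∷ᵥ _} (this x<y _) = <⇒≤ x<y
<ₗₑₓ⇒head-≤ {u = _ ∷ᵥ _} {_ ∷ᵥ _} (next refl _) = ≤-refl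

<ₗₑₓ⇒tail-<ₗₑₓ : ∀ {k} {u v : Vec ℕ (suc k)} → head u ≡ head v → u <ₗₑₓ v → tail u <ₗₑₓ tail v
<ₗₑₓ⇒tail-<ₗₑₓ {u = _ ∷ᵥ _} {_ ∷ᵥ _} x≡y (this x<y _)    = contradiction x≡y (<⇒≢ x<y)
<ₗₑₓ⇒tail-<ₗₑₓ {u = _ ∷ᵥ _} {_ ∷ᵥ _} _   (next _ xs<ys) = xs<ys

All-head : ∀ {A : Set} {k} {P : A → Set} {u : Vec A (suc k)} → All P u → P (head u)
All-head {u = _ ∷ᵥ _} (px ∷ₐ _) = px

All-tail : ∀ {A : Set} {k} {P : A → Set} {u : Vec A (suc k)} → All P u → All P (tail u)
All-tail {u = _ ∷ᵥ _} (_ ∷ₐ pxs) = pxs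

-- Given that level-preserving runs from size ≤ M have at most h M states, a run from size ≤ N
-- reaches the first drop of its level at size ≤ iterate G N (h N); recurse on the level a.
steps : (G h : ℕ → ℕ) → ℕ → ℕ → ℕ
steps G h zero    N = h N
steps G h (suc a) N = h N + steps G h a (iterate G N (h N))

lexBound : (G : ℕ → ℕ) → ℕ → ℕ → ℕ
lexBound G zero    N = 1
lexBound G (suc k) N = steps G (lexBound G k) N N

h≤steps : ∀ G h a N → h N ≤ steps G h a N
h≤steps G h zero    N = ≤-refl
h≤steps G h (suc a) N = m≤m+n _ _

module PathBounds {S : Set} (size : S → ℕ) {G : ℕ → ℕ}
         (G-mono : G Preserves _≤_ ⟶ _≤_) (G-infl : ∀ n → n ≤ G n) where

  Grows : (S → S → Set) → Set
  Grows _↝_ = ∀ {s t} → s ↝ t → size t ≤ G (size s)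

  PathsBoundedBy : (S → S → Set) → (ℕ → ℕ) → Set
  PathsBoundedBy _↝_ h = ∀ N {s u p} → size s ≤ N → Path _↝_ s u p → suc p ≤ h N

  size-along : ∀ {_↝_} → Grows _↝_ → ∀ {s u p} → Path _↝_ s u p → size u ≤ iterate G (size s) p
  size-along grows ε                       = ≤-refl
  size-along grows {p = suc p} (s↝t ◅ path) =
    ≤-trans (size-along grows path) (iterate-monoˡ-≤ G-mono p (grows s↝t))

  module LevelDescent {_↝_ : S → S → Set} (grows : Grows _↝_) (level : S → ℕ)
           (level-antitone : ∀ {s t} → s ↝ t → level t ≤ level s) where

    _↝₌_ : S → S → Set
    s ↝₌ t = s ↝ t × level t ≡ level s

    level-along : ∀ {s u p} → Path _↝₌_ s u p → level u ≡ level s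
    level-along ε                = refl
    level-along ((_ , eq) ◅ path) = trans (level-along path) eq

    record FirstDrop (s u : S) (p : ℕ) : Set where
      field
        top bottom    : S
        before after  : ℕ
        prefix        : Path _↝₌_ s top before
        drop          : top ↝ bottom
        dropped       : level bottom < level top
        suffix        : Path _↝_ bottom u after
        splits        : p ≡ before + suc after

    first-drop : ∀ {s u p} → Path _↝_ s u p → Path _↝₌_ s u p ⊎ FirstDrop s u p
    first-drop ε = inj₁ ε
    first-drop {s} (_◅_ {t = t} s↝t path) with level t ≟ level s
    ... | no ≢ = inj₂ (record
      { prefix = ε ; drop = s↝t ; dropped = ≤∧≢⇒< (level-antitone s↝t) ≢
      ; suffix = path ; splits = refl })
    ... | yes eq with first-drop path
    ...   | inj₁ flat = inj₁ ((s↝t , eq) ◅ flat)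
    ...   | inj₂ d    = inj₂ (record
      { prefix = (s↝t , eq) ◅ prefix ; drop = drop ; dropped = dropped
      ; suffix = suffix ; splits = cong suc splits })
      where open FirstDrop d

    drop-below-start : ∀ {s u p} (d : FirstDrop s u p) → level (FirstDrop.bottom d) < level s
    drop-below-start d = ≤-trans dropped (≤-reflexive (level-along prefix))
      where open FirstDrop d

    module _ {h : ℕ → ℕ} (flat-bounded : PathsBoundedBy _↝₌_ h) where

      size-after-drop : ∀ N {s u p} → size s ≤ N → (d : FirstDrop s u p) →
                        size (FirstDrop.bottom d) ≤ iterate G N (h N)
      size-after-drop N {s} sN d = begin
        size bottom                    ≤⟨ grows drop ⟩
        G (size top)                   ≤⟨ G-mono (size-along (grows ∘ proj₁) prefix) ⟩
        G (iterate G (size s) before)  ≤⟨ G-mono (iterate-monoˡ-≤ G-mono before sN) ⟩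
        G (iterate G N before)         ≡⟨ iterate-comm G N before ⟨
        iterate G N (suc before)       ≤⟨ iterate-monoʳ-≤ G-infl N (flat-bounded N sN prefix) ⟩
        iterate G N (h N)              ∎
        where open FirstDrop d
              open ≤-Reasoning

      mutual
        descent-bound : ∀ a N {s u p} → level s ≤ a → size s ≤ N → Path _↝_ s u p →
                        suc p ≤ steps G h a N
        descent-bound a N ls≤a sN path with first-drop path
        ... | inj₁ flat = ≤-trans (flat-bounded N sN flat) (h≤steps G h a N)
        ... | inj₂ d    = drop-bound a N ls≤a sN d

        drop-bound : ∀ a N {s u p} → level s ≤ a → size s ≤ N → FirstDrop s u p →
                     suc p ≤ steps G h a N
        drop-bound zero    N ls≤0 sN d = contradiction (≤-trans (drop-below-start d) ls≤0) n≮0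
        drop-bound (suc a) N ls≤a sN d rewrite FirstDrop.splits d =
          +-mono-≤ (flat-bounded N sN prefix)
            (descent-bound a _ (≤-pred (≤-trans (drop-below-start d) ls≤a))
              (size-after-drop N sN d) suffix)
          where open FirstDrop d

  lex-bound : ∀ k {_↝_ : S → S → Set} → Grows _↝_ → (rank : S → Vec ℕ k) →
              (∀ {s t} → s ↝ t → rank t <ₗₑₓ rank s) → (∀ s → All (_≤ size s) (rank s)) →
              PathsBoundedBy _↝_ (lexBound G k)
  lex-bound zero    grows rank decreasing bounded N sN ε            = ≤-refl
  lex-bound zero    grows rank decreasing bounded N sN (s↝t ◅ _)    =
    contradiction (decreasing s↝t) ¬[]<ₗₑₓ[]
  lex-bound (suc k) grows rank decreasing bounded N {s} sN path =
    descent-bound flat-bounded N N (≤-trans (All-head (bounded s)) sN) sN path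
    where
    open LevelDescent grows (head ∘ rank) (<ₗₑₓ⇒head-≤ ∘ decreasing)
    flat-bounded : PathsBoundedBy _↝₌_ (lexBound G k)
    flat-bounded = lex-bound k (grows ∘ proj₁) (tail ∘ rank)
      (λ (s↝t , eq) → <ₗₑₓ⇒tail-<ₗₑₓ eq (decreasing s↝t)) (All-tail ∘ bounded)

multiplicity : ℕ → List ℕ → ℕ
multiplicity y xs = length (filter (_≟ y) xs)

multiplicity-↭ : ∀ y {xs ys} → xs ↭ ys → multiplicity y xs ≡ multiplicity y ys
multiplicity-↭ y xs↭ys = ↭-length (filter-↭ (_≟ y) xs↭ys)

multiplicity-∷-≡ : ∀ y xs → multiplicity y (y ∷ xs) ≡ suc (multiplicity y xs)
multiplicity-∷-≡ y xs = cong length (filter-accept (_≟ y) refl)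

multiplicity-∷-≢ : ∀ {x y} xs → x ≢ y → multiplicity y (x ∷ xs) ≡ multiplicity y xs
multiplicity-∷-≢ {y = y} xs x≢y = cong length (filter-reject (_≟ y) x≢y)

multiplicity-replicate-++ : ∀ {x y} d xs → x ≢ y →
                            multiplicity y (replicate d x ++ xs) ≡ multiplicity y xs
multiplicity-replicate-++ {x} {y} d xs x≢y = begin
  length (filter (_≟ y) (replicate d x ++ xs))
    ≡⟨ cong length (filter-++ (_≟ y) (replicate d x) xs) ⟩
  length (filter (_≟ y) (replicate d x) ++ filter (_≟ y) xs)
    ≡⟨ length-++ (filter (_≟ y) (replicate d x)) ⟩
  length (filter (_≟ y) (replicate d x)) + multiplicity y xs
    ≡⟨ cong (λ l → length l + multiplicity y xs) (filter-none (_≟ y) (replicate⁺ d x≢y)) ⟩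
  multiplicity y xs ∎
  where open ≡-Reasoning

multiplicity≤sum : ∀ {y} xs → 1 ≤ y → multiplicity y xs ≤ sum xs
multiplicity≤sum     []       _   = z≤n
multiplicity≤sum {y} (x ∷ xs) 1≤y with x ≟ y
... | yes refl = ≤-trans (≤-reflexive (multiplicity-∷-≡ y xs))
                   (+-mono-≤ 1≤y (multiplicity≤sum xs 1≤y))
... | no x≢y   = ≤-trans (≤-reflexive (multiplicity-∷-≢ xs x≢y))
                   (≤-trans (multiplicity≤sum xs 1≤y) (m≤n+m (sum xs) x))

↭-∷⇒multiplicity-< : ∀ {x xs ys} → xs ↭ x ∷ ys → multiplicity x ys < multiplicity x xs
↭-∷⇒multiplicity-< {x} {ys = ys} xs↭ =
  ≤-reflexive (sym (trans (multiplicity-↭ x xs↭) (multiplicity-∷-≡ x ys)))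

↭-∷⇒multiplicity-≡ : ∀ {x y xs ys} → xs ↭ x ∷ ys → x ≢ y → multiplicity y xs ≡ multiplicity y ys
↭-∷⇒multiplicity-≡ {y = y} {ys = ys} xs↭ x≢y =
  trans (multiplicity-↭ y xs↭) (multiplicity-∷-≢ ys x≢y)

window : (ℕ → ℕ) → ℕ → (k : ℕ) → Vec ℕ k
window f lo zero    = []ᵥ
window f lo (suc k) = f lo ∷ᵥ window f (suc lo) k

window-<ₗₑₓ : ∀ {f f′ : ℕ → ℕ} k {lo x} → lo ≤ x → x < lo + k → f x < f′ x →
              (∀ y → y < x → f y ≡ f′ y) → window f lo k <ₗₑₓ window f′ lo k
window-<ₗₑₓ zero    {lo} lo≤x x<lo+0 _ _ =
  contradiction (≤-trans (≤-reflexive (+-identityʳ lo)) lo≤x) (<⇒≱ x<lo+0)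
window-<ₗₑₓ (suc k) {lo} {x} lo≤x x<lo+k fx<f′x below with lo ≟ x
... | yes refl = this fx<f′x refl
... | no lo≢x  = next (below lo lo<x)
                   (window-<ₗₑₓ k lo<x (≤-trans x<lo+k (≤-reflexive (+-suc lo k))) fx<f′x below)
  where lo<x = ≤∧≢⇒< lo≤x lo≢x

window-bounded : ∀ {f n} k {lo} → (∀ y → lo ≤ y → f y ≤ n) → All (_≤ n) (window f lo k)
window-bounded zero    _     = []ₐ
window-bounded (suc k) {lo} bound =
  bound lo ≤-refl ∷ₐ window-bounded k (λ y lo<y → bound y (<⇒≤ lo<y))

cumulative : (ℕ → ℕ) → ℕ → ℕ
cumulative g zero    = g zero
cumulative g (suc n) = g (suc n) + cumulative g n

g≤cumulative : ∀ g n → g n ≤ cumulative g n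
g≤cumulative g zero    = ≤-refl
g≤cumulative g (suc n) = m≤m+n _ _

cumulative-mono-≤ : ∀ g → cumulative g Preserves _≤_ ⟶ _≤_
cumulative-mono-≤ g {y = zero}  z≤n = ≤-refl
cumulative-mono-≤ g {m} {suc n} m≤1+n with m≤n⇒m<n∨m≡n m≤1+n
... | inj₂ refl  = ≤-refl
... | inj₁ m<1+n = ≤-trans (cumulative-mono-≤ g (≤-pred m<1+n)) (m≤n+m _ _)

envelope : (ℕ → ℕ) → ℕ → ℕ
envelope g n = n + cumulative g n

envelope-mono-≤ : ∀ g → envelope g Preserves _≤_ ⟶ _≤_
envelope-mono-≤ g m≤n = +-mono-≤ m≤n (cumulative-mono-≤ g m≤n)

envelope-infl : ∀ g n → n ≤ envelope g n
envelope-infl g n = m≤m+n n _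

g≤envelope : ∀ g n → g n ≤ envelope g n
g≤envelope g n = ≤-trans (g≤cumulative g n) (m≤n+m _ n)

Step : ℕ → (ℕ → ℕ) → BBP → BBP → Set
Step c g P Q = IsCBBP c P × IsGTransformation c g P Q

step-grows : ∀ {c g P Q} → Step c g P Q → nOf Q ≤ envelope g (nOf P)
step-grows {g = g} {P} (_ , _ , Q≤gP) = ≤-trans Q≤gP (g≤envelope g (nOf P))

rank : (c : ℕ) → BBP → Vec ℕ c
rank c P = window (λ y → multiplicity y (A P)) 1 c

rank-bounded : ∀ c P → All (_≤ nOf P) (rank c P)
rank-bounded c P = window-bounded c λ y 1≤y →
  ≤-trans (multiplicity≤sum (A P) 1≤y) (m≤n+m (sum (A P)) (2 ^ b P))

folding-decreases-rank : ∀ {c P Q} → 1 ≤ c → IsFolding c P Q → rank c Q <ₗₑₓ rank c P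
folding-decreases-rank {c} 1≤c (P↭ , _) =
  window-<ₗₑₓ c 1≤c (n<1+n c) (↭-∷⇒multiplicity-< P↭)
    (λ y y<c → sym (↭-∷⇒multiplicity-≡ P↭ (>⇒≢ y<c)))

extension-decreases-rank : ∀ {c P Q} → IsCBBP c P → IsExtension c P Q → rank c Q <ₗₑₓ rank c P
extension-decreases-rank {c} {P} {Q} cbbp (x , A₀ , d₁ , _ , x<c , P↭ , Q↭ , _) =
  window-<ₗₑₓ c 1≤x (m<n⇒m<1+n x<c)
    (≤-trans (s≤s (≤-reflexive (Q-below x ≤-refl))) (↭-∷⇒multiplicity-< P↭))
    (λ y y<x → trans (Q-below y (<⇒≤ y<x)) (sym (↭-∷⇒multiplicity-≡ P↭ (>⇒≢ y<x))))
  where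
  1≤x : 1 ≤ x
  1≤x = proj₁ (List.lookup cbbp (∈-resp-↭ (↭-sym P↭) (here refl)))
  Q-below : ∀ y → y ≤ x → multiplicity y (A Q) ≡ multiplicity y A₀
  Q-below y y≤x =
    trans (multiplicity-↭ y Q↭) (multiplicity-replicate-++ d₁ A₀ (>⇒≢ (s≤s y≤x)))

step-decreases-rank : ∀ {c g P Q} → 1 ≤ c → Step c g P Q → rank c Q <ₗₑₓ rank c P
step-decreases-rank 1≤c (_    , inj₁ folding   , _) = folding-decreases-rank 1≤c folding
step-decreases-rank _   (cbbp , inj₂ extension , _) = extension-decreases-rank cbbp extension

sequence⇒path : ∀ {c g P rest} → GSeqFrom c g P rest → ∃[ u ] Path (Step c g) P u (length rest)
sequence⇒path [ _ ]             = _ , ε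
sequence⇒path (cbbp ∷⟨ t ⟩ seq) = _ , (cbbp , t) ◅ proj₂ (sequence⇒path seq)

theoremA6 : (c : ℕ) → 1 ≤ c → (g : ℕ → ℕ) →
    Σ[ h ∈ (ℕ → ℕ) ] ((seq : List BBP) → IsGTransformationSequence c g seq →
      length seq ≤ h (firstN seq))
theoremA6 c 1≤c g = lexBound (envelope g) c , bounded
  where
  open PathBounds nOf (envelope-mono-≤ g) (envelope-infl g)
  bounded : (seq : List BBP) → IsGTransformationSequence c g seq →
            length seq ≤ lexBound (envelope g) c (firstN seq)
  bounded []         ()
  bounded (P ∷ rest) seq =
    lex-bound c step-grows (rank c) (step-decreases-rank {g = g} 1≤c) (rank-bounded c)
      (nOf P) ≤-refl (proj₂ (sequence⇒path seq))
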